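{- Let $\mathcal{F}$ be a non-trivial monotone left-compressed $t$-intersecting family on $n$ points with extent $m$ and boundary generating family $\mathcal{G}^*$. If $A,B \in \mathcal{G}^*$ intersect in exactly $t$ elements then $|A| + |B| = m + t$.
   Context: A family on $n$ points is a collection of subsets of $[n]$; it is $t$-intersecting if any two members share at least $t$ elements; monotone if closed under taking supersets within $[n]$; non-trivial if it is neither $\emptyset$ nor $2^{[n]}$; left-compressed if whenever $A\in\mathcal{F}$, $i\in A$, $j\notin A$ and $j<i$, also $(A\setminus\{i\})\cup\{j\}\in\mathcal{F}$. For a non-trivial monotone $\mathcal{F}$, a generating set is a set in $\mathcal{F}$ none of whose proper subsets lies in $\mathcal{F}$; the generating family is the set of generating sets; the extent of $\mathcal{F}$ is the largest element appearing in a generating set; the boundary generating family $\mathcal{G}^*$ consists of the generating sets that contain the extent. -}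

module Defs where

open import Data.Nat using (ℕ; suc; _≤_; _+_)
open import Data.Fin using (Fin; toℕ; _<_)
open import Data.Fin.Subset using (Subset; _∈_; _∉_; _⊆_; _⊂_; _∩_; ∣_∣; inside; outside)
open import Data.Vec using (_[_]≔_)
open import Data.Bool using (Bool; true; false)
open import Data.Product using (∃; _×_)
open import Relation.Binary.PropositionalEquality using (_≡_)

-- Ground set [n] is modelled as Fin n; element i : Fin n stands for the
-- point (toℕ i + 1) of [n] = {1,…,n}.
Family : ℕ → Set
Family n = Subset n → Bool

_∈F_ : ∀ {n} → Subset n → Family n → Set
A ∈F F = F A ≡ true

IsTIntersecting : ∀ {n} → ℕ → Family n → Set
IsTIntersecting t F = ∀ A B → A ∈F F → B ∈F F → t ≤ ∣ A ∩ B ∣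

IsMonotone : ∀ {n} → Family n → Set
IsMonotone F = ∀ A B → A ⊆ B → A ∈F F → B ∈F F

IsNonTrivial : ∀ {n} → Family n → Set
IsNonTrivial F = (∃ λ A → F A ≡ true) × (∃ λ A → F A ≡ false)

-- A ∈ F, i ∈ A, j ∉ A, j < i  ⇒  (A ∖ {i}) ∪ {j} ∈ F
IsLeftCompressed : ∀ {n} → Family n → Set
IsLeftCompressed F =
  ∀ A i j → A ∈F F → i ∈ A → j ∉ A → j < i → ((A [ i ]≔ outside) [ j ]≔ inside) ∈F F

IsGenerating : ∀ {n} → Family n → Subset n → Set
IsGenerating F G = G ∈F F × (∀ B → B ⊂ G → F B ≡ false)

IsExtent : ∀ {n} → Family n → Fin n → Set
IsExtent F e =
  (∃ λ G → IsGenerating F G × e ∈ G) ×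
  (∀ G i → IsGenerating F G → i ∈ G → toℕ i ≤ toℕ e)

InBoundary : ∀ {n} → Family n → Fin n → Subset n → Set
InBoundary F e A = IsGenerating F A × e ∈ A

extentValue : ∀ {n} → Fin n → ℕ
extentValue e = suc (toℕ e)

-- Shifting the extent e out of A and some absent j < e into it keeps A in the
-- family (left-compression), so t-intersection forces j ∈ B: otherwise the
-- shifted set meets B in A ∩ B minus e, fewer than t points. Hence A ∪ B is
-- exactly {1,…,m}, and |A| + |B| = |A ∪ B| + |A ∩ B| = m + t.
module Submission where

open import Defs
open import Data.Nat as ℕ using (ℕ; _+_; suc; z≤n; s≤s)
open import Data.Nat.Properties using (+-suc; ≤-pred; <⇒≱)
open import Data.Fin using (Fin; toℕ; zero; suc; _≤_; _<_; _≟_)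
open import Data.Fin.Properties using (≤∧≢⇒<; <⇒≢)
open import Data.Fin.Subset
  using (Subset; inside; outside; _∈_; _∉_; _⊂_; _∩_; _∪_; ∣_∣; Empty)
open import Data.Fin.Subset.Properties
  using (_∈?_; drop-there; Empty-unique; ∣⊥∣≡0; x∈p∩q⁺; x∈p∩q⁻; x∈p∪q⁺; x∈p∪q⁻; p⊂q⇒∣p∣<∣q∣)
open import Data.Vec using ([]; _∷_; there; _[_]≔_)
open import Data.Vec.Properties using ([]=⇒lookup; lookup⇒[]=; lookup∘update′; []=-injective; []≔-updates)
open import Data.Product using (_,_; proj₁)
open import Data.Sum using (inj₁; inj₂; [_,_]′)
open import Function using (_∘_; case_of_)
open import Function.Bundles using (_⇔_; mk⇔; Equivalence)
open import Relation.Nullary using (yes; no; contradiction)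
open import Relation.Binary.PropositionalEquality using (_≡_; _≢_; refl; sym; trans; cong; cong₂; subst; module ≡-Reasoning)

open Equivalence using (to; from)

private
  variable
    n : ℕ
    i j x : Fin n
    p : Subset n

∣p∣+∣q∣≡∣p∪q∣+∣p∩q∣ : ∀ (p q : Subset n) → ∣ p ∣ + ∣ q ∣ ≡ ∣ p ∪ q ∣ + ∣ p ∩ q ∣
∣p∣+∣q∣≡∣p∪q∣+∣p∩q∣ []            []            = refl
∣p∣+∣q∣≡∣p∪q∣+∣p∩q∣ (inside  ∷ p) (inside  ∷ q) = cong suc (begin
  ∣ p ∣ + suc ∣ q ∣              ≡⟨ +-suc ∣ p ∣ ∣ q ∣ ⟩
  suc (∣ p ∣ + ∣ q ∣)            ≡⟨ cong suc (∣p∣+∣q∣≡∣p∪q∣+∣p∩q∣ p q) ⟩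
  suc (∣ p ∪ q ∣ + ∣ p ∩ q ∣)    ≡⟨ +-suc ∣ p ∪ q ∣ ∣ p ∩ q ∣ ⟨
  ∣ p ∪ q ∣ + suc ∣ p ∩ q ∣      ∎)
  where open ≡-Reasoning
∣p∣+∣q∣≡∣p∪q∣+∣p∩q∣ (inside  ∷ p) (outside ∷ q) = cong suc (∣p∣+∣q∣≡∣p∪q∣+∣p∩q∣ p q)
∣p∣+∣q∣≡∣p∪q∣+∣p∩q∣ (outside ∷ p) (inside  ∷ q) =
  trans (+-suc ∣ p ∣ ∣ q ∣) (cong suc (∣p∣+∣q∣≡∣p∪q∣+∣p∩q∣ p q))
∣p∣+∣q∣≡∣p∪q∣+∣p∩q∣ (outside ∷ p) (outside ∷ q) = ∣p∣+∣q∣≡∣p∪q∣+∣p∩q∣ p q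

IsInitialSegment : Fin n → Subset n → Set
IsInitialSegment i p = ∀ j → j ∈ p ⇔ j ≤ i

∣initialSegment∣≡1+i : IsInitialSegment i p → ∣ p ∣ ≡ suc (toℕ i)
∣initialSegment∣≡1+i                     {p = outside ∷ p} seg = case from (seg zero) z≤n of λ ()
∣initialSegment∣≡1+i {suc n} {i = zero}  {p = inside  ∷ p} seg =
  cong suc (trans (cong ∣_∣ (Empty-unique p-empty)) (∣⊥∣≡0 n))
  where
  p-empty : Empty p
  p-empty (j , j∈p) = case to (seg (suc j)) (there j∈p) of λ ()
∣initialSegment∣≡1+i         {i = suc i} {p = inside  ∷ p} seg = cong suc (∣initialSegment∣≡1+i seg′)
  where
  seg′ : IsInitialSegment i p
  seg′ j = mk⇔ (≤-pred ∘ to (seg (suc j)) ∘ there) (drop-there ∘ from (seg (suc j)) ∘ s≤s)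

x∈p[i]≔s⇒x∈p : ∀ {s} → x ≢ i → x ∈ p [ i ]≔ s → x ∈ p
x∈p[i]≔s⇒x∈p {x = x} {p = p} x≢i x∈ =
  lookup⇒[]= x p (trans (sym (lookup∘update′ x≢i p _)) ([]=⇒lookup x∈))

i∉p[i]≔outside : i ∉ p [ i ]≔ outside
i∉p[i]≔outside {i = i} {p = p} i∈ = case []=-injective i∈ ([]≔-updates p i) of λ ()

shift : Fin n → Fin n → Subset n → Subset n
shift i j p = (p [ i ]≔ outside) [ j ]≔ inside

x∈shift⇒x∈p : x ≢ j → x ∈ shift i j p → x ∈ p
x∈shift⇒x∈p {x = x} {i = i} x≢j x∈ with x ≟ i
... | yes refl = contradiction (x∈p[i]≔s⇒x∈p x≢j x∈) i∉p[i]≔outside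
... | no  x≢i  = x∈p[i]≔s⇒x∈p x≢i (x∈p[i]≔s⇒x∈p x≢j x∈)

i∉shift : i ≢ j → i ∉ shift i j p
i∉shift i≢j = i∉p[i]≔outside ∘ x∈p[i]≔s⇒x∈p i≢j

tightPair-∪-downClosed : ∀ {t} {F : Family n} {A B e} →
  IsLeftCompressed F → IsTIntersecting t F → A ∈F F → B ∈F F → ∣ A ∩ B ∣ ≡ t →
  e ∈ A ∩ B → j < e → j ∈ A ∪ B
tightPair-∪-downClosed {j = j} {t = t} {F = F} {A = A} {B} {e} lc tint A∈F B∈F ∣A∩B∣≡t e∈A∩B j<e
  with j ∈? A | j ∈? B
... | yes j∈A | _       = x∈p∪q⁺ (inj₁ j∈A)
... | no  _   | yes j∈B = x∈p∪q⁺ (inj₂ j∈B)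
... | no  j∉A | no  j∉B = contradiction (tint A′ B A′∈F B∈F) (<⇒≱ ∣A′∩B∣<t)
  where
  A′ : Subset _
  A′ = shift e j A

  A′∈F : A′ ∈F F
  A′∈F = lc A e j A∈F (proj₁ (x∈p∩q⁻ A B e∈A∩B)) j∉A j<e

  A′∩B⊂A∩B : A′ ∩ B ⊂ A ∩ B
  A′∩B⊂A∩B = A′∩B⊆A∩B , e , e∈A∩B , i∉shift (<⇒≢ j<e ∘ sym) ∘ proj₁ ∘ x∈p∩q⁻ A′ B
    where
    A′∩B⊆A∩B : ∀ {x} → x ∈ A′ ∩ B → x ∈ A ∩ B
    A′∩B⊆A∩B x∈ with x∈p∩q⁻ A′ B x∈
    ... | x∈A′ , x∈B = x∈p∩q⁺ (x∈shift⇒x∈p (λ { refl → j∉B x∈B }) x∈A′ , x∈B)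

  ∣A′∩B∣<t : ∣ A′ ∩ B ∣ ℕ.< t
  ∣A′∩B∣<t = subst (∣ A′ ∩ B ∣ ℕ.<_) ∣A∩B∣≡t (p⊂q⇒∣p∣<∣q∣ A′∩B⊂A∩B)

tightBoundaryPair-∪-initialSegment : ∀ {t} {F : Family n} {e A B} →
  IsLeftCompressed F → IsTIntersecting t F → IsExtent F e →
  InBoundary F e A → InBoundary F e B → ∣ A ∩ B ∣ ≡ t → IsInitialSegment e (A ∪ B)
tightBoundaryPair-∪-initialSegment {e = e} {A} {B} lc tint (_ , below-extent)
  (genA , e∈A) (genB , e∈B) ∣A∩B∣≡t j = mk⇔ below-e covered
  where
  below-e : j ∈ A ∪ B → j ≤ e
  below-e = [ below-extent A j genA , below-extent B j genB ]′ ∘ x∈p∪q⁻ A B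

  covered : j ≤ e → j ∈ A ∪ B
  covered j≤e with j ≟ e
  ... | yes refl = x∈p∪q⁺ (inj₁ e∈A)
  ... | no  j≢e  = tightPair-∪-downClosed lc tint (proj₁ genA) (proj₁ genB) ∣A∩B∣≡t
                     (x∈p∩q⁺ (e∈A , e∈B)) (≤∧≢⇒< j≤e j≢e)

lemma2p23 : (n t : ℕ) (F : Family n) (e : Fin n) →
    IsNonTrivial F → IsMonotone F → IsLeftCompressed F → IsTIntersecting t F →
    IsExtent F e →
    ∀ A B → InBoundary F e A → InBoundary F e B → ∣ A ∩ B ∣ ≡ t →
    ∣ A ∣ + ∣ B ∣ ≡ extentValue e + t
lemma2p23 n t F e _ _ lc tint extent A B A∈G* B∈G* ∣A∩B∣≡t = begin
  ∣ A ∣ + ∣ B ∣          ≡⟨ ∣p∣+∣q∣≡∣p∪q∣+∣p∩q∣ A B ⟩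
  ∣ A ∪ B ∣ + ∣ A ∩ B ∣  ≡⟨ cong₂ _+_ ∣A∪B∣≡m ∣A∩B∣≡t ⟩
  extentValue e + t      ∎
  where
  open ≡-Reasoning
  ∣A∪B∣≡m : ∣ A ∪ B ∣ ≡ extentValue e
  ∣A∪B∣≡m = ∣initialSegment∣≡1+i
    (tightBoundaryPair-∪-initialSegment lc tint extent A∈G* B∈G* ∣A∩B∣≡t)
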